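{- The greedy algorithm $\mathcal A$ is a $2$-approximation algorithm for maximum $\gamma$-matching: for every positive integer $\gamma$, every link stream $L$, the $\gamma$-matching $\mathcal M$ returned by $\mathcal A$ on $L$ and every $\gamma$-matching $\mathcal M'$ of $L$, we have $|\mathcal M'|\le 2|\mathcal M|$.
   Context: A link stream is a triple $L=(T,V,E)$ where $T\subseteq\mathbb N$ is an interval of integers, $V$ is a finite set of vertices, and $E\subseteq T\times\binom{V}{2}$ is a set of timed edges $(t,\{u,v\})$ with $u\neq v$. A temporal vertex is a pair $(t,u)$ with $t\in T$, $u\in V$. For time $t$ and distinct vertices $u,v$, the $\gamma$-edge $\Gamma_\gamma(t,u,v)$ is the set $\{(t',\{u,v\}) : t'\in\{t,\dots,t+\gamma-1\}\}$. A $\gamma$-edge $\Gamma$ contains the temporal vertex $(t,u)$ if $(t,\{u,v\})\in\Gamma$ for some vertex $v$. Two $\gamma$-edges are independent if no temporal vertex is contained in both. A $\gamma$-matching of $L$ is a set of pairwise independent $\gamma$-edges each of which is a subset of $E$. The greedy algorithm $\mathcal A$: let $\mathcal P$ be the set of all $\gamma$-edges that are subsets of $E$, and fix a total order $\preceq$ on $\mathcal P$ such that $\Gamma_\gamma(t_1,u_1,v_1)\preceq\Gamma_\gamma(t_2,u_2,v_2)$ whenever $t_1<t_2$ (ties broken arbitrarily). Starting from $\mathcal M=\emptyset$, scan $\mathcal P$ in increasing $\preceq$ order and add the current $\gamma$-edge $\Gamma$ to $\mathcal M$ if and only if none of the $2\gamma$ temporal vertices contained in $\Gamma$ is contained in a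 $\gamma$-edge already in $\mathcal M$; return $\mathcal M$. -}

module Defs where

open import Data.Nat using (ℕ; _+_; _≤_; _<_)
open import Data.Fin as Fin using (Fin)
open import Data.Product using (_×_; _,_)
open import Data.Sum using (_⊎_)
open import Data.List using (List; []; _∷_)
open import Data.List.Membership.Propositional using (_∈_)
open import Data.List.Relation.Unary.All using (All)
open import Data.List.Relation.Unary.Any using (Any)
open import Data.List.Relation.Unary.AllPairs using (AllPairs)
open import Data.List.Relation.Unary.Unique.Propositional using (Unique)
open import Relation.Binary.PropositionalEquality using (_≡_)
open import Relation.Nullary using (¬_)
open import Function.Bundles using (_⇔_)

-- An unordered pair {u,v} with u ≠ v is represented
-- canonically by (u , v) with u < v.  A triple (t, u, v) with u < v is used
-- both for the timed edge (t,{u,v}) and for the γ-edge Γ_γ(t,u,v).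
record Triple (n : ℕ) : Set where
  constructor trip
  field
    time : ℕ
    lo   : Fin n
    hi   : Fin n
    .lo<hi : lo Fin.< hi
open Triple public

TimedEdge : ℕ → Set
TimedEdge = Triple

GammaEdge : ℕ → Set
GammaEdge = Triple

-- A link stream L = (T, V, E): T = {tlo, …, thi-1} an interval of ℕ,
-- V = Fin n, E a finite set (given as a list, read as a set via ∈) of
-- timed edges, all with times in T.
record LinkStream : Set where
  field
    n   : ℕ
    tlo thi : ℕ
    E   : List (TimedEdge n)
    E⊆T : All (λ e → tlo ≤ time e × time e < thi) E
open LinkStream public

TemporalVertex : ℕ → Set
TemporalVertex n = ℕ × Fin n

SubsetOfE : (γ : ℕ) (L : LinkStream) → GammaEdge (n L) → Set
SubsetOfE γ L (trip t u v p) =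
  ∀ k → k < γ → trip (t + k) u v p ∈ E L

-- Γ_γ(t,u,v) contains temporal vertex (s, w): (s,{w,x}) ∈ Γ for some x,
-- i.e. t ≤ s ≤ t+γ-1 and w ∈ {u, v}.
Contains : ∀ {n} (γ : ℕ) → GammaEdge n → TemporalVertex n → Set
Contains γ (trip t u v _) (s , w) = (t ≤ s × s < t + γ) × (w ≡ u ⊎ w ≡ v)

Independent : ∀ {n} (γ : ℕ) → GammaEdge n → GammaEdge n → Set
Independent γ Γ Γ' = ∀ x → ¬ (Contains γ Γ x × Contains γ Γ' x)

-- A γ-matching: pairwise independent γ-edges (as a duplicate-free list,
-- duplicates being excluded by pairwise independence), each ⊆ E.
IsGammaMatching : (γ : ℕ) (L : LinkStream) → List (GammaEdge (n L)) → Set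
IsGammaMatching γ L M = All (SubsetOfE γ L) M × AllPairs (Independent γ) M

-- An admissible scanning order of 𝒫: a list enumerating each γ-edge that is a
-- subset of E exactly once, such that Γ₁ comes before Γ₂ whenever
-- time Γ₁ < time Γ₂ (equivalently: times are non-decreasing along the list;
-- ties broken arbitrarily).
IsGreedyOrder : (γ : ℕ) (L : LinkStream) → List (GammaEdge (n L)) → Set
IsGreedyOrder γ L ord =
  (∀ Γ → (Γ ∈ ord) ⇔ SubsetOfE γ L Γ)
  × Unique ord
  × AllPairs (λ Γ₁ Γ₂ → time Γ₁ ≤ time Γ₂) ord

Free : ∀ {n} (γ : ℕ) → GammaEdge n → List (GammaEdge n) → Set
Free γ Γ M = ∀ x → Contains γ Γ x → ¬ Any (λ Γ' → Contains γ Γ' x) M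

data Scan {n : ℕ} (γ : ℕ) : List (GammaEdge n) → List (GammaEdge n) → List (GammaEdge n) → Set where
  done : ∀ {M} → Scan γ M [] M
  add  : ∀ {M Γ rest R} → Free γ Γ M → Scan γ (Γ ∷ M) rest R → Scan γ M (Γ ∷ rest) R
  skip : ∀ {M Γ rest R} → ¬ Free γ Γ M → Scan γ M rest R → Scan γ M (Γ ∷ rest) R

GreedyReturns : ∀ {n} (γ : ℕ) → List (GammaEdge n) → List (GammaEdge n) → Set
GreedyReturns γ ord R = Scan γ [] ord R

-- Charge every γ-edge Γ' of an optimal matching M' to a γ-edge Γ of the greedy
-- matching M that starts no later than Γ' and shares a temporal vertex with it:
-- Γ' itself if it was picked, otherwise the edge of M that made the greedy
-- algorithm reject Γ' (it was picked earlier because the scan is sorted by time).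
-- The shared vertex lies on one of the two endpoints w of Γ, inside Γ's time
-- window.  Two γ-edges charged to the same endpoint of Γ both start in that
-- window and both contain w, so both contain w at the later of their two start
-- times; hence they are not independent.  So the charging injects M' into
-- {lo, hi} × M.
module Submission where

open import Defs
open import Data.Nat using (ℕ; _≤_; _*_; _+_; _<_; _≤?_; s≤s)
open import Data.Nat.Properties using (≰⇒>; ≤-refl; ≤-total; m<m+n; <-≤-trans; ≤-<-trans; +-monoˡ-≤)
open import Data.Fin as Fin using (Fin; combine)
open import Data.Fin.Properties using (pigeonhole; combine-injective)
open import Data.List using (List; []; _∷_; length; lookup)
open import Data.List.Membership.Propositional using (_∈_; find)
open import Data.List.Membership.Propositional.Properties using (∈-lookup)
open import Data.List.Relation.Binary.Subset.Propositional using (_⊆_)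
open import Data.List.Relation.Unary.All as All using (All; []; _∷_)
open import Data.List.Relation.Unary.Any as Any using (here; there)
open import Data.List.Relation.Unary.Any.Properties using (lookup-index)
open import Data.List.Relation.Unary.AllPairs using (AllPairs; []; _∷_)
open import Data.Product using (∃; _×_; _,_; proj₁; proj₂; uncurry)
open import Data.Product.Properties using (×-≡,≡→≡)
open import Data.Sum using (inj₁; inj₂)
open import Function.Bundles using (Equivalence)
open import Function.Definitions using (Injective)
open import Level using (0ℓ)
open import Relation.Nullary using (¬_)
open import Relation.Nullary.Decidable using (decidable-stable)
open import Relation.Nullary.Negation using (contradiction; ¬¬-Monad; ¬¬-map)
open import Relation.Binary.PropositionalEquality using (_≡_; refl; sym; subst)

All-lookup-index : ∀ {A : Set} {P : A → Set} {xs : List A} →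
  All P xs → (i : Fin (length xs)) → P (lookup xs i)
All-lookup-index pxs i = All.lookup pxs (∈-lookup i)

AllPairs-lookup-index : ∀ {A : Set} {R : A → A → Set} {xs : List A} → AllPairs R xs →
  ∀ {i j : Fin (length xs)} → i Fin.< j → R (lookup xs i) (lookup xs j)
AllPairs-lookup-index (rx ∷ _)   {Fin.zero}  {Fin.suc j} _           = All-lookup-index rx j
AllPairs-lookup-index (_ ∷ rxss) {Fin.suc i} {Fin.suc j} (s≤s i<j) =
  AllPairs-lookup-index rxss i<j

length≤-by-separating-labels : ∀ {A B : Set} {k : ℕ} {R : A → A → Set} {xs : List A}
  (Q : B → A → Set) (encode : B → Fin k) → Injective _≡_ _≡_ encode →
  (∀ {b x y} → Q b x → Q b y → ¬ R x y) →
  AllPairs R xs → All (λ x → ∃ λ b → Q b x) xs → length xs ≤ k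
length≤-by-separating-labels {B = B} {k = k} {xs = xs}
    Q encode encode-injective separated related labelled =
  decidable-stable (length xs ≤? k) λ xs≰k →
    let i , j , i<j , same-code = pigeonhole (≰⇒> xs≰k) (λ i → encode (label i))
        Qᵢⱼ = subst (λ b → Q b (lookup xs j)) (sym (encode-injective same-code)) (labelled-by j)
    in  contradiction (AllPairs-lookup-index related i<j) (separated (labelled-by i) Qᵢⱼ)
  where
  label : Fin (length xs) → B
  label i = proj₁ (All-lookup-index labelled i)
  labelled-by : ∀ i → Q (label i) (lookup xs i)
  labelled-by i = proj₂ (All-lookup-index labelled i)

module _ {n : ℕ} (γ : ℕ) where

  Meets : GammaEdge n → GammaEdge n → Set
  Meets Γ Γ' = ∃ λ x → Contains γ Γ x × Contains γ Γ' x

  Blocked : List (GammaEdge n) → GammaEdge n → Set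
  Blocked R Γ' = ∃ λ Γ → Γ ∈ R × time Γ ≤ time Γ' × Meets Γ Γ'

  contains-start : 1 ≤ γ → (Γ : GammaEdge n) → Contains γ Γ (time Γ , lo Γ)
  contains-start γ≥1 Γ = (≤-refl , m<m+n (time Γ) γ≥1) , inj₁ refl

  scan-⊇ : ∀ {M rest R : List (GammaEdge n)} → Scan γ M rest R → M ⊆ R
  scan-⊇ done         = λ Γ∈M → Γ∈M
  scan-⊇ (add _ scan) = λ Γ∈M → scan-⊇ scan (there Γ∈M)
  scan-⊇ (skip _ scan) = scan-⊇ scan

  -- Rejection of a γ-edge only yields ¬ Free, a negated universal over temporal
  -- vertices, hence ¬ ¬ Blocked; the decidable final inequality absorbs the ¬ ¬.
  scan-blocks : 1 ≤ γ → ∀ {M rest R : List (GammaEdge n)} → Scan γ M rest R →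
    All (λ Γ → All (λ Γ' → time Γ ≤ time Γ') rest) M →
    AllPairs (λ Γ₁ Γ₂ → time Γ₁ ≤ time Γ₂) rest →
    All (λ Γ' → ¬ ¬ Blocked R Γ') rest
  scan-blocks γ≥1 done _ [] = []
  scan-blocks γ≥1 (add {Γ = Γ'} _ scan) earlier (later ∷ sorted) =
    (λ unblocked → unblocked (Γ' , scan-⊇ scan (here refl) , ≤-refl , _ , start , start))
    ∷ scan-blocks γ≥1 scan (later ∷ All.map All.tail earlier) sorted
    where start = contains-start γ≥1 Γ'
  scan-blocks γ≥1 (skip {Γ = Γ'} occupied scan) earlier (_ ∷ sorted) =
    (λ unblocked → occupied λ x Γ'∋x M∋x →
      let Γ , Γ∈M , Γ∋x = find M∋x
      in  unblocked (Γ , scan-⊇ scan Γ∈M , All.head (All.lookup earlier Γ∈M) , x , Γ∋x , Γ'∋x))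
    ∷ scan-blocks γ≥1 scan (All.map All.tail earlier) sorted

  endpoint : Fin 2 → GammaEdge n → Fin n
  endpoint Fin.zero    Γ = lo Γ
  endpoint (Fin.suc _) Γ = hi Γ

  record ChargedTo (Γ : GammaEdge n) (side : Fin 2) (Γ' : GammaEdge n) : Set where
    constructor charged
    field
      starts-no-earlier : time Γ ≤ time Γ'
      moment            : ℕ
      moment<end        : moment < time Γ + γ
      contains-endpoint : Contains γ Γ' (moment , endpoint side Γ)

  meets⇒charged : ∀ {Γ Γ'} → time Γ ≤ time Γ' → Meets Γ Γ' → ∃ λ side → ChargedTo Γ side Γ'
  meets⇒charged Γ≤Γ' (_ , ((_ , s<end) , inj₁ refl) , Γ'∋x) = Fin.zero , charged Γ≤Γ' _ s<end Γ'∋x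
  meets⇒charged Γ≤Γ' (_ , ((_ , s<end) , inj₂ refl) , Γ'∋x) = Fin.suc Fin.zero , charged Γ≤Γ' _ s<end Γ'∋x

  charged-start<end : ∀ {Γ side Γ'} → ChargedTo Γ side Γ' → time Γ' < time Γ + γ
  charged-start<end (charged _ _ s<end ((Γ'≤s , _) , _)) = ≤-<-trans Γ'≤s s<end

  charged⇒contains : ∀ {Γ side Γ' t} → ChargedTo Γ side Γ' →
    time Γ' ≤ t → t < time Γ + γ → Contains γ Γ' (t , endpoint side Γ)
  charged⇒contains (charged Γ≤Γ' _ _ (_ , w∈Γ')) Γ'≤t t<end =
    (Γ'≤t , <-≤-trans t<end (+-monoˡ-≤ γ Γ≤Γ')) , w∈Γ'

  charged-same⇒dependent : ∀ {Γ side A B} → ChargedTo Γ side A → ChargedTo Γ side B →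
    ¬ Independent γ A B
  charged-same⇒dependent {Γ} {side} {A} {B} A↦ B↦ independent with ≤-total (time A) (time B)
  ... | inj₁ A≤B = independent (time B , endpoint side Γ)
        (charged⇒contains A↦ A≤B (charged-start<end B↦) ,
         charged⇒contains B↦ ≤-refl (charged-start<end B↦))
  ... | inj₂ B≤A = independent (time A , endpoint side Γ)
        (charged⇒contains A↦ ≤-refl (charged-start<end A↦) ,
         charged⇒contains B↦ B≤A (charged-start<end A↦))

  blocked⇒charged : ∀ {M Γ'} → Blocked M Γ' →
    ∃ λ ((side , i) : Fin 2 × Fin (length M)) → ChargedTo (lookup M i) side Γ'
  blocked⇒charged {Γ' = Γ'} (Γ , Γ∈M , Γ≤Γ' , meet) =
    let side , Γ'↦Γ = meets⇒charged Γ≤Γ' meet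
    in  (side , Any.index Γ∈M) , subst (λ Γ → ChargedTo Γ side Γ') (lookup-index Γ∈M) Γ'↦Γ

  independent-blocked⇒length≤ : ∀ {M M'} → AllPairs (Independent γ) M' →
    All (Blocked M) M' → length M' ≤ 2 * length M
  independent-blocked⇒length≤ {M} independent blocked =
    length≤-by-separating-labels (λ (side , i) → ChargedTo (lookup M i) side)
      (uncurry combine) (λ same → ×-≡,≡→≡ (combine-injective _ _ _ _ same))
      charged-same⇒dependent independent (All.map blocked⇒charged blocked)

corollary3 : (γ : ℕ) → 1 ≤ γ → (L : LinkStream) →
    (ord : List (GammaEdge (n L))) → IsGreedyOrder γ L ord →
    (M : List (GammaEdge (n L))) → GreedyReturns γ ord M →
    (M' : List (GammaEdge (n L))) → IsGammaMatching γ L M' →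
    length M' ≤ 2 * length M
corollary3 γ γ≥1 L ord (enumerates , _ , sorted) M greedy M' (M'⊆E , independent) =
  decidable-stable (length M' ≤? 2 * length M)
    (¬¬-map (independent-blocked⇒length≤ γ independent)
      (All.sequenceM 0ℓ {P = Blocked γ M} ¬¬-Monad blocked))
  where
  blocked : All (λ Γ' → ¬ ¬ Blocked γ M Γ') M'
  blocked = All.map (λ {Γ'} Γ'⊆E →
    All.lookup (scan-blocks γ γ≥1 greedy [] sorted) (Equivalence.from (enumerates Γ') Γ'⊆E)) M'⊆E
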